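{- Let $\mathfrak{F}=\langle W,P,R\rangle$ be a birelational frame and let $w,w'\in W$ with $w\,P\,w'$. Then for every path $\rho$ in $\mathfrak{F}$ with $\rho_0=w$ there is a path $\tau$ in $\mathfrak{F}$ with $\tau_0=w'$ such that $\rho_i\,P\,\tau_i$ for every $i\in\mathbb{N}$.
   Context: A birelational frame is a triple $\langle W,P,R\rangle$ where $W$ is a non-empty countable set, $P$ is a preorder on $W$ (reflexive and transitive), and $R$ is a serial binary relation on $W$ (for every $x\in W$ there is $y\in W$ with $x\,R\,y$), satisfying for all $x,y,z\in W$: (C1) if $x\,R\,y$ and $y\,P\,z$, then there is $u\in W$ with $x\,P\,u$ and $u\,R\,z$; (C2) if $x\,P\,z$ and $x\,R\,y$, then there is $u\in W$ with $y\,P\,u$ and $z\,R\,u$. A path in the frame is an infinite sequence $\rho=\rho_0,\rho_1,\ldots$ of elements of $W$ with $\rho_i\,R\,\rho_{i+1}$ for all $i\in\mathbb{N}$. -}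

module Defs where

open import Level using (Level; _⊔_)
open import Data.Nat using (ℕ; suc)
open import Data.Product using (Σ; ∃; _×_; _,_)
open import Relation.Binary.PropositionalEquality using (_≡_)
open import Relation.Binary.Definitions using (Reflexive; Transitive)

-- A birelational frame ⟨W,P,R⟩: W non-empty and countable (witnessed by a
-- surjection ℕ → W), P a preorder, R serial, satisfying (C1) and (C2).
record BirelationalFrame (a ℓ₁ ℓ₂ : Level) : Set (Level.suc (a ⊔ ℓ₁ ⊔ ℓ₂)) where
  field
    W          : Set a
    P          : W → W → Set ℓ₁
    R          : W → W → Set ℓ₂
    enum       : ℕ → W
    enum-surj  : ∀ (x : W) → ∃ λ n → enum n ≡ x
    P-refl     : Reflexive P
    P-trans    : Transitive P
    R-serial   : ∀ (x : W) → ∃ λ y → R x y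
    C1         : ∀ {x y z : W} → R x y → P y z → ∃ λ u → P x u × R u z
    C2         : ∀ {x y z : W} → P x z → R x y → ∃ λ u → P y u × R z u

record Path {a ℓ₁ ℓ₂} (F : BirelationalFrame a ℓ₁ ℓ₂) : Set (a ⊔ ℓ₂) where
  open BirelationalFrame F
  field
    seq  : ℕ → W
    step : ∀ (i : ℕ) → R (seq i) (seq (suc i))

module Submission where

open import Defs
open import Level using (Level)
open import Data.Nat using (ℕ; zero; suc)
open import Data.Product using (Σ; ∃; _×_; _,_; proj₁; proj₂)
open import Relation.Binary.PropositionalEquality using (_≡_; refl)

-- Condition (C2) alone suffices: it lets each step ρᵢ R ρᵢ₊₁ be shadowed by a
-- step τᵢ R τᵢ₊₁ above it, so τ is built step by step with ρᵢ P τᵢ as invariant.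

module _ {a ℓ₁ ℓ₂ : Level} (F : BirelationalFrame a ℓ₁ ℓ₂) (ρ : Path F) where
  open BirelationalFrame F
  open Path ρ

  shadow : {w′ : W} → P (seq 0) w′ → (i : ℕ) → ∃ λ t → P (seq i) t
  shadow {w′} p zero    = w′ , p
  shadow p      (suc i) = let (u , ρ₁Pu , _) = C2 (proj₂ (shadow p i)) (step i) in u , ρ₁Pu

  shadow-step : {w′ : W} (p : P (seq 0) w′) (i : ℕ) →
                R (proj₁ (shadow p i)) (proj₁ (shadow p (suc i)))
  shadow-step p i = proj₂ (proj₂ (C2 (proj₂ (shadow p i)) (step i)))

  shadow-path : {w′ : W} → P (seq 0) w′ → Path F
  shadow-path p = record { seq = λ i → proj₁ (shadow p i) ; step = shadow-step p }

lemma1 : ∀ {a ℓ₁ ℓ₂ : Level} (F : BirelationalFrame a ℓ₁ ℓ₂)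
           (w w′ : BirelationalFrame.W F) → BirelationalFrame.P F w w′ →
           (ρ : Path F) → Path.seq ρ 0 ≡ w →
           Σ (Path F) (λ τ → (Path.seq τ 0 ≡ w′) ×
             (∀ (i : ℕ) → BirelationalFrame.P F (Path.seq ρ i) (Path.seq τ i)))
lemma1 F w w′ wPw′ ρ refl = shadow-path F ρ wPw′ , refl , λ i → proj₂ (shadow F ρ wPw′ i)
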